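{- Let $G$ be a group. The power graph $\mathfrak{g}(G)$ is complete if and only if the cyclic subgroup graph $C(G)$ is complete.
   Context: The power graph $\mathfrak{g}(G)$ has vertex set $G$, distinct $x,y$ adjacent iff $\langle x\rangle\le\langle y\rangle$ or $\langle y\rangle\le\langle x\rangle$. Define $x\sim y$ iff $\langle x\rangle=\langle y\rangle$, with classes $[x]_\sim$. The cyclic subgroup graph $C(G)$ is the undirected graph with vertex set $G/\!\sim$, where distinct classes $A,B$ are adjacent iff there exist $a\in A$, $b\in B$ with $\langle b\rangle<\langle a\rangle$ or $\langle a\rangle<\langle b\rangle$. -}

module Defs where

open import Level using (Level; _⊔_)
open import Algebra.Bundles using (Group)
open import Data.Nat using (ℕ; zero; suc)
open import Data.Integer using (ℤ; +_; -[1+_])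
open import Data.Product using (∃; _×_)
open import Data.Sum using (_⊎_)
open import Relation.Nullary using (¬_)

module GroupDefs {c ℓ : Level} (G : Group c ℓ) where
  open Group G

  _^ℕ_ : Carrier → ℕ → Carrier
  x ^ℕ zero  = ε
  x ^ℕ suc n = x ∙ (x ^ℕ n)

  _^ℤ_ : Carrier → ℤ → Carrier
  x ^ℤ (+ n)     = x ^ℕ n
  x ^ℤ -[1+ n ]  = (x ^ℕ suc n) ⁻¹

  _∈⟨_⟩ : Carrier → Carrier → Set ℓ
  g ∈⟨ x ⟩ = ∃ λ (k : ℤ) → g ≈ x ^ℤ k

  _≤⟨⟩_ : Carrier → Carrier → Set (c ⊔ ℓ)
  x ≤⟨⟩ y = ∀ g → g ∈⟨ x ⟩ → g ∈⟨ y ⟩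

  _<⟨⟩_ : Carrier → Carrier → Set (c ⊔ ℓ)
  x <⟨⟩ y = x ≤⟨⟩ y × ¬ (y ≤⟨⟩ x)

  _∼_ : Carrier → Carrier → Set (c ⊔ ℓ)
  x ∼ y = x ≤⟨⟩ y × y ≤⟨⟩ x

  PowerAdj : Carrier → Carrier → Set (c ⊔ ℓ)
  PowerAdj x y = x ≤⟨⟩ y ⊎ y ≤⟨⟩ x

  PowerGraphComplete : Set (c ⊔ ℓ)
  PowerGraphComplete = ∀ x y → ¬ (x ≈ y) → PowerAdj x y

  -- adjacency in C(G) between the classes [x]∼ and [y]∼ (given by representatives):
  -- there exist a ∈ [x]∼, b ∈ [y]∼ with ⟨b⟩ < ⟨a⟩ or ⟨a⟩ < ⟨b⟩
  CycAdj : Carrier → Carrier → Set (c ⊔ ℓ)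
  CycAdj x y = ∃ λ a → ∃ λ b → a ∼ x × b ∼ y × (b <⟨⟩ a ⊎ a <⟨⟩ b)

  -- C(G) is complete: any two distinct classes are adjacent
  -- (classes [x]∼, [y]∼ are distinct iff ¬ (x ∼ y))
  CycSubgroupGraphComplete : Set (c ⊔ ℓ)
  CycSubgroupGraphComplete = ∀ x y → ¬ (x ∼ y) → CycAdj x y

open GroupDefs public

-- Comparability of ⟨x⟩ and ⟨y⟩ transfers between representatives of ∼-classes,
-- so for non-equivalent x, y both graphs ask for the same thing: a strict
-- inclusion between ⟨x⟩ and ⟨y⟩. Distinct but equivalent elements are adjacent
-- in the power graph anyway; excluded middle decides which case applies.
module Submission where

open import Defs using (module GroupDefs; PowerGraphComplete; CycSubgroupGraphComplete)
open import Level using (Level; _⊔_)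
open import Algebra.Bundles using (Group)
open import Axiom.ExcludedMiddle using (ExcludedMiddle)
open import Function.Bundles using (_⇔_; mk⇔)
open import Data.Nat using (zero; suc)
open import Data.Integer using (+_; -[1+_])
open import Data.Product using (_,_)
open import Data.Sum using (inj₁; inj₂)
open import Relation.Nullary using (¬_; yes; no)

module _ {c ℓ : Level} (G : Group c ℓ) where
  open Group G
  open GroupDefs G hiding (PowerGraphComplete; CycSubgroupGraphComplete)

  ^ℕ-cong : ∀ {x y} → x ≈ y → ∀ n → x ^ℕ n ≈ y ^ℕ n
  ^ℕ-cong x≈y zero    = refl
  ^ℕ-cong x≈y (suc n) = ∙-cong x≈y (^ℕ-cong x≈y n)

  ^ℤ-cong : ∀ {x y} → x ≈ y → ∀ k → x ^ℤ k ≈ y ^ℤ k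
  ^ℤ-cong x≈y (+ n)    = ^ℕ-cong x≈y n
  ^ℤ-cong x≈y -[1+ n ] = ⁻¹-cong (^ℕ-cong x≈y (suc n))

  ≤⟨⟩-reflexive : ∀ {x y} → x ≈ y → x ≤⟨⟩ y
  ≤⟨⟩-reflexive x≈y g (k , g≈xᵏ) = k , trans g≈xᵏ (^ℤ-cong x≈y k)

  ≤⟨⟩-trans : ∀ {x y z} → x ≤⟨⟩ y → y ≤⟨⟩ z → x ≤⟨⟩ z
  ≤⟨⟩-trans x≤y y≤z g g∈⟨x⟩ = y≤z g (x≤y g g∈⟨x⟩)

  ∼-refl : ∀ {x} → x ∼ x
  ∼-refl = (λ _ g∈⟨x⟩ → g∈⟨x⟩) , (λ _ g∈⟨x⟩ → g∈⟨x⟩)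

  ∼-reflexive : ∀ {x y} → x ≈ y → x ∼ y
  ∼-reflexive x≈y = ≤⟨⟩-reflexive x≈y , ≤⟨⟩-reflexive (sym x≈y)

  ∼⇒powerAdj : ∀ {x y} → x ∼ y → PowerAdj x y
  ∼⇒powerAdj (x≤y , _) = inj₁ x≤y

  powerAdj⇒cycAdj : ∀ {x y} → ¬ x ∼ y → PowerAdj x y → CycAdj x y
  powerAdj⇒cycAdj x≁y (inj₁ x≤y) =
    _ , _ , ∼-refl , ∼-refl , inj₂ (x≤y , λ y≤x → x≁y (x≤y , y≤x))
  powerAdj⇒cycAdj x≁y (inj₂ y≤x) =
    _ , _ , ∼-refl , ∼-refl , inj₁ (y≤x , λ x≤y → x≁y (x≤y , y≤x))

  cycAdj⇒powerAdj : ∀ {x y} → CycAdj x y → PowerAdj x y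
  cycAdj⇒powerAdj (_ , _ , (a≤x , x≤a) , (b≤y , y≤b) , inj₁ (b≤a , _)) =
    inj₂ (≤⟨⟩-trans y≤b (≤⟨⟩-trans b≤a a≤x))
  cycAdj⇒powerAdj (_ , _ , (a≤x , x≤a) , (b≤y , y≤b) , inj₂ (a≤b , _)) =
    inj₁ (≤⟨⟩-trans x≤a (≤⟨⟩-trans a≤b b≤y))

  powerGraphComplete⇒cycSubgroupGraphComplete :
    PowerGraphComplete G → CycSubgroupGraphComplete G
  powerGraphComplete⇒cycSubgroupGraphComplete complete x y x≁y =
    powerAdj⇒cycAdj x≁y (complete x y (λ x≈y → x≁y (∼-reflexive x≈y)))

  cycSubgroupGraphComplete⇒powerGraphComplete : ExcludedMiddle (c ⊔ ℓ) →
    CycSubgroupGraphComplete G → PowerGraphComplete G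
  cycSubgroupGraphComplete⇒powerGraphComplete em complete x y _ with em {x ∼ y}
  ... | yes x∼y = ∼⇒powerAdj x∼y
  ... | no  x≁y = cycAdj⇒powerAdj (complete x y x≁y)

proposition13 : ∀ {c ℓ} → ExcludedMiddle (c ⊔ ℓ) → (G : Group c ℓ) →
    PowerGraphComplete G ⇔ CycSubgroupGraphComplete G
proposition13 em G = mk⇔
  (powerGraphComplete⇒cycSubgroupGraphComplete G)
  (cycSubgroupGraphComplete⇒powerGraphComplete G em)
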